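{- Let $e_1$ be an expression. $(\mathrm{cKA},\{e_1\leq 1\})$ reduces to $(\mathrm{cKA},\emptyset)$.
   Context: Take $\Sigma=\{\cdot,1\}$ and $E$ the commutative monoid equations; atoms are finite multisets and languages are sets of multisets. Expressions are restricted to the fragment where all fixpoints have the shape $e^*=\mu x.1+e\cdot x$, and cKA is the commutative Kleene algebra axiomatisation, sound and complete for the empty set of hypotheses. $[\![e]\!]_E$ is the standard language interpretation. For a set $H$ of hypotheses, $H^*(L)$ is the least language containing $L$ closed under: if $C[\![f]\!]_E\subseteq L$ for a context $C$ (a multiset, acting by multiset union) and $(e\leq f)\in H$ then $C[\![e]\!]_E\subseteq L$. The representation $(Q,H)$ interprets $e$ as $H^*[\![e]\!]_E$ with equivalence $e\equiv f$ iff $Q,H\vdash e\leq f$ and $Q,H\vdash f\leq e$. $(Q,H)$ reduces to $(Q',H')$ if there are maps $r,i$ on expressions and $\iota$ from $H$-closed to $H'$-closed languages with: $e'\equiv' f'\Rightarrow i(e')\equiv i(f')$; $i(r(e))\equiv e$; $\iota(H^*[\![e]\!]_E)=H'^*[\![r(e)]\!]_E$. -}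

module Defs where

open import Data.List using (List; []; _∷_; _++_; [_])
open import Data.List.Membership.Propositional using (_∈_)
open import Data.List.Relation.Binary.Permutation.Propositional
  using (_↭_; ↭-trans; ↭-sym)
open import Data.Product using (Σ; ∃; ∃-syntax; _×_; _,_; proj₁; proj₂)
open import Data.Sum using (_⊎_; inj₁; inj₂)
open import Data.Empty using (⊥)

infixl 6 _⊕_
infixl 7 _⊙_
infix  8 _⋆

data Exp (A : Set) : Set where
  0e  : Exp A
  1e  : Exp A
  var : A → Exp A
  _⊕_ : Exp A → Exp A → Exp A
  _⊙_ : Exp A → Exp A → Exp A
  _⋆  : Exp A → Exp A

-- Multisets are represented by lists up to permutation (_↭_);
-- a language is a predicate on lists invariant under permutation
-- (i.e. a set of finite multisets).  Multiset union is _++_.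

record Lang (A : Set) : Set₁ where
  field
    mem : List A → Set
    inv : ∀ {u w} → u ↭ w → mem u → mem w
open Lang public

_≐_ : ∀ {A} → Lang A → Lang A → Set
L ≐ K = (∀ w → mem L w → mem K w) × (∀ w → mem K w → mem L w)

data Star {A : Set} (P : List A → Set) : List A → Set where
  nil  : ∀ {w} → w ↭ [] → Star P w
  cons : ∀ {w u v} → P u → Star P v → w ↭ u ++ v → Star P w

⟦_⟧ : ∀ {A} → Exp A → List A → Set
⟦ 0e ⟧ w = ⊥
⟦ 1e ⟧ w = w ↭ []
⟦ var a ⟧ w = w ↭ [ a ]
⟦ e ⊕ f ⟧ w = ⟦ e ⟧ w ⊎ ⟦ f ⟧ w
⟦ e ⊙ f ⟧ w = ∃[ u ] ∃[ v ] (⟦ e ⟧ u × ⟦ f ⟧ v × w ↭ u ++ v)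
⟦ e ⋆ ⟧ w = Star ⟦ e ⟧ w

⟦⟧-inv : ∀ {A} (e : Exp A) {u w} → u ↭ w → ⟦ e ⟧ u → ⟦ e ⟧ w
⟦⟧-inv 0e p ()
⟦⟧-inv 1e p q = ↭-trans (↭-sym p) q
⟦⟧-inv (var a) p q = ↭-trans (↭-sym p) q
⟦⟧-inv (e ⊕ f) p (inj₁ x) = inj₁ (⟦⟧-inv e p x)
⟦⟧-inv (e ⊕ f) p (inj₂ y) = inj₂ (⟦⟧-inv f p y)
⟦⟧-inv (e ⊙ f) p (u , v , x , y , q) = u , v , x , y , ↭-trans (↭-sym p) q
⟦⟧-inv (e ⋆) p (nil q) = nil (↭-trans (↭-sym p) q)
⟦⟧-inv (e ⋆) p (cons x s q) = cons x s (↭-trans (↭-sym p) q)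

⟦_⟧L : ∀ {A} → Exp A → Lang A
⟦ e ⟧L = record { mem = ⟦ e ⟧ ; inv = ⟦⟧-inv e }

-- Hypotheses: a list of inequations (e ≤ f), each given as the pair (e , f).

Hyps : Set → Set
Hyps A = List (Exp A × Exp A)

-- H^*(L): least language containing L closed under
--   C[[f]] ⊆ L  and  (e ≤ f) ∈ H   ⟹   C[[e]] ⊆ L
-- (the context C is a multiset acting by multiset union).
data HS {A : Set} (H : Hyps A) (P : List A → Set) : List A → Set where
  base : ∀ {w} → P w → HS H P w
  step : ∀ {e f w} → (e , f) ∈ H → (c u : List A) → ⟦ e ⟧ u →
         (∀ v → ⟦ f ⟧ v → HS H P (c ++ v)) → w ↭ c ++ u → HS H P w

HS-inv : ∀ {A} (H : Hyps A) (L : Lang A) {u w} → u ↭ w → HS H (mem L) u → HS H (mem L) w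
HS-inv H L p (base x) = base (inv L p x)
HS-inv H L p (step h c u x k q) = step h c u x k (↭-trans (↭-sym p) q)

_^*_ : ∀ {A} → Hyps A → Lang A → Lang A
H ^* L = record { mem = HS H (mem L) ; inv = HS-inv H L }

-- H-closed languages: H^*(L) = L (i.e. H^*(L) ⊆ L)
Closed : ∀ {A} → Hyps A → Lang A → Set
Closed H L = ∀ w → mem (H ^* L) w → mem L w

^*-closed : ∀ {A} (H : Hyps A) (L : Lang A) → Closed H (H ^* L)
^*-closed H L w (base x) = x
^*-closed H L w (step h c u x k q) = step h c u x (λ v y → ^*-closed H L (c ++ v) (k v y)) q

infix 4 _⊢_≈_ _⊢_≤_ _⊢_≡_

data _⊢_≈_ {A : Set} (H : Hyps A) : Exp A → Exp A → Set where
  refl  : ∀ {e} → H ⊢ e ≈ e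
  sym   : ∀ {e f} → H ⊢ e ≈ f → H ⊢ f ≈ e
  trans : ∀ {e f g} → H ⊢ e ≈ f → H ⊢ f ≈ g → H ⊢ e ≈ g
  ⊕-cong : ∀ {e e' f f'} → H ⊢ e ≈ e' → H ⊢ f ≈ f' → H ⊢ e ⊕ f ≈ e' ⊕ f'
  ⊙-cong : ∀ {e e' f f'} → H ⊢ e ≈ e' → H ⊢ f ≈ f' → H ⊢ e ⊙ f ≈ e' ⊙ f'
  ⋆-cong : ∀ {e e'} → H ⊢ e ≈ e' → H ⊢ e ⋆ ≈ e' ⋆
  ⊕-assoc : ∀ {e f g} → H ⊢ (e ⊕ f) ⊕ g ≈ e ⊕ (f ⊕ g)
  ⊕-comm  : ∀ {e f} → H ⊢ e ⊕ f ≈ f ⊕ e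
  ⊕-idem  : ∀ {e} → H ⊢ e ⊕ e ≈ e
  ⊕-zero  : ∀ {e} → H ⊢ e ⊕ 0e ≈ e
  ⊙-assoc : ∀ {e f g} → H ⊢ (e ⊙ f) ⊙ g ≈ e ⊙ (f ⊙ g)
  ⊙-comm  : ∀ {e f} → H ⊢ e ⊙ f ≈ f ⊙ e
  ⊙-unit  : ∀ {e} → H ⊢ e ⊙ 1e ≈ e
  ⊙-zero  : ∀ {e} → H ⊢ e ⊙ 0e ≈ 0e
  distrib : ∀ {e f g} → H ⊢ e ⊙ (f ⊕ g) ≈ (e ⊙ f) ⊕ (e ⊙ g)
  ⋆-unfold : ∀ {e} → H ⊢ (1e ⊕ e ⊙ (e ⋆)) ⊕ e ⋆ ≈ e ⋆
  ⋆-ind    : ∀ {e f g} → H ⊢ (f ⊕ e ⊙ g) ⊕ g ≈ g → H ⊢ (e ⋆ ⊙ f) ⊕ g ≈ g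
  hyp : ∀ {e f} → (e , f) ∈ H → H ⊢ e ⊕ f ≈ f

_⊢_≤_ : ∀ {A} → Hyps A → Exp A → Exp A → Set
H ⊢ e ≤ f = H ⊢ e ⊕ f ≈ f

_⊢_≡_ : ∀ {A} → Hyps A → Exp A → Exp A → Set
H ⊢ e ≡ f = (H ⊢ e ≤ f) × (H ⊢ f ≤ e)

record Reduces {A : Set} (H H' : Hyps A) : Set₁ where
  field
    r : Exp A → Exp A
    i : Exp A → Exp A
    ι : (L : Lang A) → Closed H L → Σ (Lang A) (Closed H')
    i-resp : ∀ e f → H' ⊢ e ≡ f → H ⊢ i e ≡ i f
    i-r    : ∀ e → H ⊢ i (r e) ≡ e
    ι-spec : ∀ e → proj₁ (ι (H ^* ⟦ e ⟧L) (^*-closed H ⟦ e ⟧L)) ≐ (H' ^* ⟦ r e ⟧L)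

-- Under the hypothesis e₁ ≤ 1 one derives e₁⋆ = 1, so r(e) = e · e₁⋆ is an
-- invertible translation (with i the identity).  Semantically, closing [[e]]
-- under e₁ ≤ 1 lets one insert, one at a time, any number of words of e₁
-- into a word of e; the resulting language is exactly [[e · e₁⋆]], which is
-- already closed under the empty set of hypotheses.
module Submission where

open import Defs
open import Data.List using (List; []; [_]; _++_)
open import Data.List.Membership.Propositional using (_∈_)
open import Data.List.Relation.Unary.Any using (here; there)
open import Data.List.Relation.Binary.Subset.Propositional using (_⊆_)
open import Data.List.Relation.Binary.Permutation.Propositional
  using (_↭_; ↭-refl; ↭-sym; ↭-trans; module PermutationReasoning)
open import Data.List.Relation.Binary.Permutation.Propositional.Properties
  using (++⁺ˡ; ++⁺ʳ; ++-identityʳ; ++-assoc; ++-comm)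
open import Data.Product using (_,_; proj₁; proj₂)
open import Relation.Binary.PropositionalEquality as ≡ using ()

module _ {A : Set} where

  weaken : ∀ {H H' : Hyps A} {e f} → H ⊆ H' → H ⊢ e ≈ f → H' ⊢ e ≈ f
  weaken H⊆H' refl = refl
  weaken H⊆H' (sym p) = sym (weaken H⊆H' p)
  weaken H⊆H' (trans p q) = trans (weaken H⊆H' p) (weaken H⊆H' q)
  weaken H⊆H' (⊕-cong p q) = ⊕-cong (weaken H⊆H' p) (weaken H⊆H' q)
  weaken H⊆H' (⊙-cong p q) = ⊙-cong (weaken H⊆H' p) (weaken H⊆H' q)
  weaken H⊆H' (⋆-cong p) = ⋆-cong (weaken H⊆H' p)
  weaken H⊆H' ⊕-assoc = ⊕-assoc
  weaken H⊆H' ⊕-comm = ⊕-comm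
  weaken H⊆H' ⊕-idem = ⊕-idem
  weaken H⊆H' ⊕-zero = ⊕-zero
  weaken H⊆H' ⊙-assoc = ⊙-assoc
  weaken H⊆H' ⊙-comm = ⊙-comm
  weaken H⊆H' ⊙-unit = ⊙-unit
  weaken H⊆H' ⊙-zero = ⊙-zero
  weaken H⊆H' distrib = distrib
  weaken H⊆H' ⋆-unfold = ⋆-unfold
  weaken H⊆H' (⋆-ind p) = ⋆-ind (weaken H⊆H' p)
  weaken H⊆H' (hyp h) = hyp (H⊆H' h)

  module _ {H : Hyps A} where

    ≤-refl : ∀ {e} → H ⊢ e ≤ e
    ≤-refl = ⊕-idem

    ≈⇒≤ : ∀ {e f} → H ⊢ e ≈ f → H ⊢ e ≤ f
    ≈⇒≤ p = trans (⊕-cong p refl) ⊕-idem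

    ≤-trans : ∀ {e f g} → H ⊢ e ≤ f → H ⊢ f ≤ g → H ⊢ e ≤ g
    ≤-trans e≤f f≤g =
      trans (⊕-cong refl (sym f≤g))
        (trans (sym ⊕-assoc) (trans (⊕-cong e≤f refl) f≤g))

    ⊕-lub : ∀ {e f g} → H ⊢ e ≤ g → H ⊢ f ≤ g → H ⊢ e ⊕ f ≤ g
    ⊕-lub e≤g f≤g = trans ⊕-assoc (trans (⊕-cong refl f≤g) e≤g)

    e≤e⊕f : ∀ {e f} → H ⊢ e ≤ e ⊕ f
    e≤e⊕f = trans (sym ⊕-assoc) (⊕-cong ⊕-idem refl)

    ⊙-monoʳ-≤ : ∀ {e f g} → H ⊢ f ≤ g → H ⊢ e ⊙ f ≤ e ⊙ g
    ⊙-monoʳ-≤ f≤g = trans (sym distrib) (⊙-cong refl f≤g)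

    1≤⋆ : ∀ {e} → H ⊢ 1e ≤ e ⋆
    1≤⋆ = ≤-trans e≤e⊕f (≤-trans e≤e⊕f (≈⇒≤ ⋆-unfold))

    -- ⋆-induction with f = g = 1, after writing e⋆ as e⋆ ⊙ 1.
    ⋆≤1 : ∀ {e} → H ⊢ e ≤ 1e → H ⊢ e ⋆ ≤ 1e
    ⋆≤1 e≤1 = ≤-trans (≈⇒≤ (sym ⊙-unit))
                (⋆-ind (⊕-lub ≤-refl (≤-trans (≈⇒≤ ⊙-unit) e≤1)))

    ⊙-⋆-subunit : ∀ {e g} → H ⊢ g ≤ 1e → H ⊢ e ⊙ g ⋆ ≡ e
    ⊙-⋆-subunit g≤1 =
      ≤-trans (⊙-monoʳ-≤ (⋆≤1 g≤1)) (≈⇒≤ ⊙-unit) ,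
      ≤-trans (≈⇒≤ (sym ⊙-unit)) (⊙-monoʳ-≤ 1≤⋆)

  HS-[]⇒ : ∀ {P : List A → Set} {w} → HS [] P w → P w
  HS-[]⇒ (base x) = x
  HS-[]⇒ (step () c u x k q)

  open PermutationReasoning {A = A}

  Star-subunit⇒HS : ∀ {H g} → (g , 1e) ∈ H → (L : Lang A) →
                    ∀ {a b} → mem L a → Star ⟦ g ⟧ b → HS H (mem L) (a ++ b)
  Star-subunit⇒HS g∈H L {a} {b} x (nil b↭[]) = base (inv L a↭a++b x)
    where
    a↭a++b : a ↭ a ++ b
    a↭a++b = begin
      a       ↭⟨ ++-identityʳ a ⟨
      a ++ [] ↭⟨ ++⁺ˡ a b↭[] ⟨
      a ++ b  ∎
  Star-subunit⇒HS {H} g∈H L {a} {b} x (cons {u = u} {v} y st b↭u++v) =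
    step g∈H (a ++ v) u y
      (λ v' v'↭[] → HS-inv H L (↭-sym (a++v++v'↭a++v v'↭[]))
                                (Star-subunit⇒HS g∈H L x st))
      a++b↭a++v++u
    where
    a++v++v'↭a++v : ∀ {v'} → v' ↭ [] → (a ++ v) ++ v' ↭ a ++ v
    a++v++v'↭a++v {v'} v'↭[] = begin
      (a ++ v) ++ v' ↭⟨ ++⁺ˡ (a ++ v) v'↭[] ⟩
      (a ++ v) ++ [] ↭⟨ ++-identityʳ (a ++ v) ⟩
      a ++ v         ∎
    a++b↭a++v++u : a ++ b ↭ (a ++ v) ++ u
    a++b↭a++v++u = begin
      a ++ b         ↭⟨ ++⁺ˡ a b↭u++v ⟩
      a ++ (u ++ v)  ↭⟨ ++⁺ˡ a (++-comm u v) ⟩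
      a ++ (v ++ u)  ↭⟨ ++-assoc a v u ⟨
      (a ++ v) ++ u  ∎

  -- Each use of g ≤ 1 replaces a word of g by the empty word; following the
  -- continuation at the empty word and collecting the replaced words gives g⋆.
  HS-subunit⇒⊙⋆ : ∀ {g} e {w} → HS [ (g , 1e) ] ⟦ e ⟧ w → ⟦ e ⊙ g ⋆ ⟧ w
  HS-subunit⇒⊙⋆ e {w} (base x) = w , [] , x , nil ↭-refl , ↭-sym (++-identityʳ w)
  HS-subunit⇒⊙⋆ e {w} (step (here ≡.refl) c u x k w↭c++u)
    with HS-subunit⇒⊙⋆ e (k [] ↭-refl)
  ... | a , b , y , st , c++[]↭a++b = a , u ++ b , y , cons x st ↭-refl , w↭a++u++b
    where
    w↭a++u++b : w ↭ a ++ (u ++ b)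
    w↭a++u++b = begin
      w             ↭⟨ w↭c++u ⟩
      c ++ u        ↭⟨ ++⁺ʳ u (↭-trans (↭-sym (++-identityʳ c)) c++[]↭a++b) ⟩
      (a ++ b) ++ u ↭⟨ ++-assoc a b u ⟩
      a ++ (b ++ u) ↭⟨ ++⁺ˡ a (++-comm b u) ⟩
      a ++ (u ++ b) ∎
  HS-subunit⇒⊙⋆ e (step (there ()) c u x k q)

  subunit-closure : (g e : Exp A) → ([ (g , 1e) ] ^* ⟦ e ⟧L) ≐ ⟦ e ⊙ g ⋆ ⟧L
  subunit-closure g e =
    (λ w → HS-subunit⇒⊙⋆ e) ,
    (λ { w (a , b , x , st , w↭a++b) →
           HS-inv _ ⟦ e ⟧L (↭-sym w↭a++b) (Star-subunit⇒HS (here ≡.refl) ⟦ e ⟧L x st) })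

lemma7p5 : {A : Set} (e₁ : Exp A) → Reduces [ (e₁ , 1e) ] []
lemma7p5 e₁ = record
  { r      = λ e → e ⊙ e₁ ⋆
  ; i      = λ e → e
  ; ι      = λ L _ → L , λ w → HS-[]⇒
  ; i-resp = λ { e f (e≤f , f≤e) → weaken (λ ()) e≤f , weaken (λ ()) f≤e }
  ; i-r    = λ e → ⊙-⋆-subunit (hyp (here ≡.refl))
  ; ι-spec = ι-spec
  }
  where
  ι-spec : ∀ e → ([ (e₁ , 1e) ] ^* ⟦ e ⟧L) ≐ ([] ^* ⟦ e ⊙ e₁ ⋆ ⟧L)
  ι-spec e =
    (λ w x → base (proj₁ (subunit-closure e₁ e) w x)) ,
    (λ w x → proj₂ (subunit-closure e₁ e) w (HS-[]⇒ x))
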